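{- For any integers $k,d\geq 1$ there is a graph $G_{k,d}$ with circumference at most $2^k$ such that every $k$-colouring of $G_{k,d}$ contains a vertex of monochromatic degree at least $d$.
   Context: All graphs are finite and simple. A $k$-colouring of a graph is an arbitrary assignment of one of $k$ colours to each vertex (adjacent vertices may receive the same colour). The monochromatic degree of a vertex $v$ in a vertex-coloured graph is the number of neighbours of $v$ that have the same colour as $v$. The circumference of a graph $G$ is the length of a longest cycle in $G$ if $G$ contains a cycle, and is $2$ if $G$ is a forest. -}

module Defs where

open import Data.Nat using (ℕ; suc; _≤_; _^_)
open import Data.Fin using (Fin; zero; suc)
open import Data.Product using (Σ; _×_; ∃)
open import Relation.Binary.PropositionalEquality using (_≡_)
open import Relation.Nullary using (¬_; yes; no)
import Data.Nat
open import Function.Definitions using (Injective)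
open import Level using (0ℓ)

record Graph : Set₁ where
  field
    n     : ℕ
    Adj   : Fin n → Fin n → Set
    sym   : ∀ {u v} → Adj u v → Adj v u
    irrefl : ∀ {v} → ¬ Adj v v

open Graph public

cyc : ∀ {L} → Fin L → Fin L
cyc {suc L} i with Data.Fin.toℕ i Data.Nat.<? L
... | yes p = suc (Data.Fin.fromℕ< p)
... | no _  = zero

record Cycle (G : Graph) (L : ℕ) : Set where
  field
    len≥3  : 3 ≤ L
    vertex : Fin L → Fin (n G)
    inj    : Injective _≡_ _≡_ vertex
    adj    : ∀ i → Adj G (vertex i) (vertex (cyc i))

-- Circumference at most m: every cycle has length ≤ m, and (for forests,
-- whose circumference is 2 by convention) 2 ≤ m.
CircumferenceAtMost : Graph → ℕ → Set
CircumferenceAtMost G m = 2 ≤ m × (∀ L → Cycle G L → L ≤ m)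

Colouring : Graph → ℕ → Set
Colouring G k = Fin (n G) → Fin k

MonoDegAtLeast : (G : Graph) {k : ℕ} → Colouring G k → Fin (n G) → ℕ → Set
MonoDegAtLeast G c v d =
  Σ (Fin d → Fin (n G)) λ w →
    Injective _≡_ _≡_ w × (∀ j → Adj G v (w j) × c (w j) ≡ c v)

-- The graph is the closure of the complete d-ary tree of height k: words of
-- length at most k over d letters, two words adjacent when one is a proper
-- prefix of the other.
--
-- Removing the root (the empty word) from a path leaves at
-- most two root-free paths, and a root-free path stays inside one subtree, so
-- paths in a tree of height h have fewer than 2^(h+1) vertices. A cycle
-- through the root is the root plus a root-free path; a cycle avoiding it is
-- itself a root-free path. Either way a cycle has at most 2^h vertices.
--
-- By induction on the height, every colouring has a vertex of
-- monochromatic degree d or h+1 vertices of pairwise different colours. If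
-- every subtree has such a rainbow set, either one of them misses the root's
-- colour, and the root extends it, or every subtree contains a vertex of the
-- root's colour, and these d vertices are neighbours of the root. With
-- k colours a rainbow set of size k+1 is impossible.
module Submission where

open import Defs hiding (sym)
open import Level using (Level)
open import Data.Nat using (ℕ; zero; suc; _+_; _*_; _^_; _≤_; _<_; _≥_; _<?_; z≤n; s≤s; s≤s⁻¹)
open import Data.Nat.Properties using (<-irrefl; +-mono-≤; +-identityʳ; <⇒≤; <-≤-trans; n≤1+n; n<1+n; m^n>0; ^-monoʳ-≤)
open import Data.Fin using (Fin; zero; suc; toℕ; fromℕ; inject₁; combine; remQuot)
open import Data.Fin.Properties using (suc-injective; toℕ-injective; toℕ-inject₁; toℕ-fromℕ; toℕ-fromℕ<; toℕ<n; combine-injective; combine-remQuot; remQuot-combine; pigeonhole; ¬∀⟶∃¬; _≟_)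
import Data.Fin.Properties as Fin
open import Data.List using (List; []; _∷_; _++_; [_]; map; length; tabulate; head; last)
open import Data.List.Properties using (∷-injective; length-map; length-++; length-tabulate)
open import Data.List.Relation.Unary.All as All using (All; []; _∷_)
import Data.List.Relation.Unary.All.Properties as All
open import Data.List.Relation.Unary.Any using (any?)
open import Data.List.Relation.Unary.AllPairs using (AllPairs; []; _∷_)
open import Data.List.Relation.Unary.Linked as Linked using (Linked; []; [-]; _∷_)
open import Data.List.Relation.Unary.Linked.Properties using (++⁺) renaming (map⁻ to Linked-map⁻)
open import Data.List.Relation.Unary.Unique.Propositional using (Unique)
import Data.List.Relation.Unary.Unique.Propositional.Properties as Unique
open import Data.List.Membership.Propositional.Properties using (∈-∃++)
open import Data.List.Relation.Binary.Permutation.Propositional using (_↭_; ↭-trans; ↭-prep; ↭⇒↭ₛ)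
open import Data.List.Relation.Binary.Permutation.Propositional.Properties using (shift; ++-comm; ↭-length; All-resp-↭)
import Data.List.Relation.Binary.Permutation.Setoid.Properties as Permutationₛ
open import Data.Maybe using (Maybe; just; nothing)
open import Data.Maybe.Relation.Binary.Connected using (Connected; just; just-nothing; nothing-just; nothing)
open import Data.Product using (Σ; ∃; ∃₂; _×_; _,_; proj₁; proj₂; uncurry)
import Data.Product as Product
open import Data.Product.Properties using (×-≡,≡→≡)
open import Data.Sum using (_⊎_; inj₁; inj₂)
open import Data.Empty using (⊥-elim)
open import Function using (_∘_)
open import Function.Definitions using (Injective)
open import Relation.Binary using (Rel)
open import Relation.Binary.PropositionalEquality using (_≡_; _≢_; refl; sym; trans; cong; subst; subst₂; setoid; module ≡-Reasoning)
open import Relation.Nullary using (¬_; Dec; yes; no)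
open import Relation.Unary using (Pred)

private
  variable
    a p q ℓ : Level
    A : Set a

∃⊎∀ : ∀ {m} {P : Pred (Fin m) p} {Q : Pred (Fin m) q} →
      (∀ i → P i ⊎ Q i) → ∃ P ⊎ (∀ i → Q i)
∃⊎∀ {m = zero} _ = inj₂ λ ()
∃⊎∀ {m = suc m} {P = P} {Q = Q} P⊎Q with P⊎Q zero | ∃⊎∀ {P = P ∘ suc} {Q = Q ∘ suc} (P⊎Q ∘ suc)
... | inj₁ P0 | _              = inj₁ (zero , P0)
... | inj₂ Q0 | inj₁ (i , Pi)  = inj₁ (suc i , Pi)
... | inj₂ Q0 | inj₂ Q-rest    = inj₂ λ { zero → Q0 ; (suc i) → Q-rest i }

remQuot-injective : ∀ {m} n {i j : Fin (m * n)} → remQuot {m} n i ≡ remQuot n j → i ≡ j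
remQuot-injective {m} n {i} {j} eq = begin
  i                                  ≡⟨ sym (combine-remQuot {m} n i) ⟩
  uncurry combine (remQuot {m} n i)  ≡⟨ cong (uncurry combine) eq ⟩
  uncurry combine (remQuot {m} n j)  ≡⟨ combine-remQuot {m} n j ⟩
  j                                  ∎
  where open ≡-Reasoning

cyc-inject₁ : ∀ {L} (j : Fin L) → cyc (inject₁ j) ≡ suc j
cyc-inject₁ {L} j with toℕ (inject₁ j) <? L
... | yes j<L = cong suc (toℕ-injective (trans (toℕ-fromℕ< j<L) (toℕ-inject₁ j)))
... | no j≮L  = ⊥-elim (j≮L (subst (_< L) (sym (toℕ-inject₁ j)) (toℕ<n j)))

cyc-fromℕ : ∀ L → cyc (fromℕ L) ≡ zero
cyc-fromℕ L with toℕ (fromℕ L) <? L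
... | yes L<L = ⊥-elim (<-irrefl (toℕ-fromℕ L) L<L)
... | no _    = refl

+-suc-<-2^suc : ∀ h {m n} → m < 2 ^ h → n < 2 ^ h → m + suc n < 2 ^ suc h
+-suc-<-2^suc h {m} {n} m< n< =
  subst (suc m + suc n ≤_) (cong (2 ^ h +_) (sym (+-identityʳ (2 ^ h)))) (+-mono-≤ m< n<)

Cyclic : Rel A ℓ → List A → Set _
Cyclic R xs = Linked R xs × Connected R (last xs) (head xs)

module _ {R : Rel A ℓ} where

  Linked-++⁻ : ∀ xs {ys} → Linked R (xs ++ ys) → Linked R xs × Linked R ys
  Linked-++⁻ []           l       = [] , l
  Linked-++⁻ (x ∷ [])     l       = [-] , Linked.tail l
  Linked-++⁻ (x ∷ y ∷ xs) (r ∷ l) = Product.map₁ (r ∷_) (Linked-++⁻ (y ∷ xs) l)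

  AllPairs-++⁻ : ∀ xs {ys} → AllPairs R (xs ++ ys) → AllPairs R xs × AllPairs R ys
  AllPairs-++⁻ []       ps        = [] , ps
  AllPairs-++⁻ (x ∷ xs) (px ∷ ps) = Product.map₁ (All.++⁻ˡ xs px ∷_) (AllPairs-++⁻ xs ps)

  last-++-∷ : ∀ xs {y : A} {ys} → last (xs ++ y ∷ ys) ≡ last (y ∷ ys)
  last-++-∷ []            = refl
  last-++-∷ (x ∷ [])      = refl
  last-++-∷ (x ∷ x′ ∷ xs) = last-++-∷ (x′ ∷ xs)

  Connected-nothingʳ : ∀ (mx : Maybe A) → Connected R mx nothing
  Connected-nothingʳ (just _) = just-nothing
  Connected-nothingʳ nothing  = nothing

  Cyclic-delete : ∀ xs {y ys} → Cyclic R (xs ++ y ∷ ys) → Linked R (ys ++ xs)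
  Cyclic-delete xs {y} {ys} (l , closing) =
    ++⁺ (Linked.tail (proj₂ (Linked-++⁻ xs l))) (closing-edge xs ys closing) (proj₁ (Linked-++⁻ xs l))
    where
      closing-edge : ∀ xs ys → Connected R (last (xs ++ y ∷ ys)) (head (xs ++ y ∷ ys)) →
                     Connected R (last ys) (head xs)
      closing-edge []       ys       _ = Connected-nothingʳ (last ys)
      closing-edge (x ∷ xs) []       _ = nothing-just
      closing-edge (x ∷ xs) (z ∷ zs) c = subst (λ mz → Connected R mz (just x)) (last-++-∷ (x ∷ xs)) c

  tabulate-Linked : ∀ {L} (f : Fin (suc L) → A) →
                    (∀ j → R (f (inject₁ j)) (f (suc j))) → Linked R (tabulate f)
  tabulate-Linked {L = zero}  f r = [-]
  tabulate-Linked {L = suc L} f r = r zero ∷ tabulate-Linked (f ∘ suc) (r ∘ suc)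

  last-tabulate : ∀ {L} (f : Fin (suc L) → A) → last (tabulate f) ≡ just (f (fromℕ L))
  last-tabulate {L = zero}  f = refl
  last-tabulate {L = suc L} f = last-tabulate (f ∘ suc)

  tabulate-Cyclic : ∀ {L} (f : Fin L → A) → (∀ i → R (f i) (f (cyc i))) → Cyclic R (tabulate f)
  tabulate-Cyclic {L = zero}  f r = [] , nothing
  tabulate-Cyclic {L = suc L} f r =
    tabulate-Linked f (λ j → subst (R (f (inject₁ j)) ∘ f) (cyc-inject₁ j) (r (inject₁ j))) ,
    subst (λ mx → Connected R mx (just (f zero))) (sym (last-tabulate f))
          (just (subst (R (f (fromℕ L)) ∘ f) (cyc-fromℕ L) (r (fromℕ L))))

Rainbow : (G : Graph) {k : ℕ} → Colouring G k → ℕ → Set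
Rainbow G c m = Σ (Fin m → Fin (n G)) λ f → Injective _≡_ _≡_ (c ∘ f)

Rainbow-∷ : (G : Graph) {k m : ℕ} (c : Colouring G k) (v : Fin (n G)) →
            ((f , _) : Rainbow G c m) → ¬ (∃ λ j → c (f j) ≡ c v) → Rainbow G c (suc m)
Rainbow-∷ G {m = m} c v (f , injective) missed = g , g-injective
  where
    g : Fin (suc m) → Fin (n G)
    g zero    = v
    g (suc j) = f j
    g-injective : Injective _≡_ _≡_ (c ∘ g)
    g-injective {zero}  {zero}  _  = refl
    g-injective {zero}  {suc j} eq = ⊥-elim (missed (j , sym eq))
    g-injective {suc i} {zero}  eq = ⊥-elim (missed (i , eq))
    g-injective {suc i} {suc j} eq = cong suc (injective eq)

no-Rainbow : (G : Graph) {k : ℕ} (c : Colouring G k) → ¬ Rainbow G c (suc k)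
no-Rainbow G c (f , injective) with i , j , i<j , eq ← pigeonhole (n<1+n _) (c ∘ f) =
  Fin.<-irrefl (injective eq) i<j

module Words {A : Set} where

  infix 4 _⊏_

  data _⊏_ : List A → List A → Set where
    []⊏∷ : ∀ {a w} → [] ⊏ a ∷ w
    ∷⊏∷  : ∀ {a v w} → v ⊏ w → a ∷ v ⊏ a ∷ w

  Comparable : Rel (List A) _
  Comparable v w = v ⊏ w ⊎ w ⊏ v

  Depth≤ : ℕ → List A → Set
  Depth≤ h w = length w ≤ h

  ⊏-irrefl : ∀ {w} → ¬ w ⊏ w
  ⊏-irrefl (∷⊏∷ w⊏w) = ⊏-irrefl w⊏w

  Comparable-irrefl : ∀ {w} → ¬ Comparable w w
  Comparable-irrefl (inj₁ w⊏w) = ⊏-irrefl w⊏w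
  Comparable-irrefl (inj₂ w⊏w) = ⊏-irrefl w⊏w

  Comparable-sym : ∀ {v w} → Comparable v w → Comparable w v
  Comparable-sym (inj₁ v⊏w) = inj₂ v⊏w
  Comparable-sym (inj₂ w⊏v) = inj₁ w⊏v

  Comparable-∷⁺ : ∀ {a v w} → Comparable v w → Comparable (a ∷ v) (a ∷ w)
  Comparable-∷⁺ (inj₁ v⊏w) = inj₁ (∷⊏∷ v⊏w)
  Comparable-∷⁺ (inj₂ w⊏v) = inj₂ (∷⊏∷ w⊏v)

  Comparable-∷⁻ : ∀ {a b v w} → Comparable (a ∷ v) (b ∷ w) → a ≡ b × Comparable v w
  Comparable-∷⁻ (inj₁ (∷⊏∷ v⊏w)) = refl , inj₁ v⊏w
  Comparable-∷⁻ (inj₂ (∷⊏∷ w⊏v)) = refl , inj₂ w⊏v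

  []≟ : (w : List A) → Dec ([] ≡ w)
  []≟ []      = yes refl
  []≟ (_ ∷ _) = no λ ()

  Depth≤0⇒≡[] : ∀ {w} → Depth≤ 0 w → w ≡ []
  Depth≤0⇒≡[] {[]} _ = refl

  -- Consecutive non-empty words of a path are comparable, hence share their
  -- first letter.
  rootless-Linked⇒map-∷ : ∀ {xs} → Linked Comparable xs → All ([] ≢_) xs →
                           xs ≡ [] ⊎ ∃₂ λ a vs → xs ≡ map (a ∷_) vs
  rootless-Linked⇒map-∷ [] [] = inj₁ refl
  rootless-Linked⇒map-∷ {[] ∷ _} _ (nonroot ∷ _) = ⊥-elim (nonroot refl)
  rootless-Linked⇒map-∷ {(a ∷ v) ∷ []} _ _ = inj₂ (a , [ v ] , refl)
  rootless-Linked⇒map-∷ {(a ∷ v) ∷ _ ∷ _} (c ∷ l) (_ ∷ nonroots)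
    with rootless-Linked⇒map-∷ l nonroots
  ... | inj₁ ()
  ... | inj₂ (_ , [] , ())
  ... | inj₂ (_ , u ∷ us , refl) with refl ← proj₁ (Comparable-∷⁻ c) = inj₂ (a , v ∷ u ∷ us , refl)

  module _ {a : A} {vs : List (List A)} where

    Linked-map-∷⁻ : Linked Comparable (map (a ∷_) vs) → Linked Comparable vs
    Linked-map-∷⁻ = Linked.map (proj₂ ∘ Comparable-∷⁻) ∘ Linked-map⁻

    Depth≤-map-∷⁻ : ∀ {h} → All (Depth≤ (suc h)) (map (a ∷_) vs) → All (Depth≤ h) vs
    Depth≤-map-∷⁻ = All.map s≤s⁻¹ ∘ All.map⁻

  Unique-Depth≤0⇒length≤1 : ∀ {xs} → Unique xs → All (Depth≤ 0) xs → length xs ≤ 1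
  Unique-Depth≤0⇒length≤1 []                  _               = z≤n
  Unique-Depth≤0⇒length≤1 (_ ∷ [])            _               = s≤s z≤n
  Unique-Depth≤0⇒length≤1 ((x≢y ∷ _) ∷ _ ∷ _) (x≤0 ∷ y≤0 ∷ _) =
    ⊥-elim (x≢y (trans (Depth≤0⇒≡[] x≤0) (sym (Depth≤0⇒≡[] y≤0))))

  root-shift : ∀ xs {ys : List (List A)} → xs ++ [ [] ] ++ ys ↭ [] ∷ xs ++ ys
  root-shift xs = shift [] xs _

  root-rotate : ∀ xs {ys : List (List A)} → xs ++ [ [] ] ++ ys ↭ [] ∷ ys ++ xs
  root-rotate xs {ys} = ↭-trans (root-shift xs) (↭-prep [] (++-comm xs ys))

  Unique-resp-↭ : ∀ {xs ys} → xs ↭ ys → Unique xs → Unique ys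
  Unique-resp-↭ = Permutationₛ.Unique-resp-↭ (setoid (List A)) ∘ ↭⇒↭ₛ

  path-length : ∀ h {xs} → Linked Comparable xs → Unique xs → All (Depth≤ h) xs →
                length xs < 2 ^ suc h
  rootless-path-length : ∀ h {xs} → Linked Comparable xs → Unique xs →
                         All (Depth≤ (suc h)) xs → All ([] ≢_) xs → length xs < 2 ^ suc h

  rootless-path-length h l u d nonroots with rootless-Linked⇒map-∷ l nonroots
  ... | inj₁ refl = m^n>0 2 (suc h)
  ... | inj₂ (a , vs , refl) =
    subst (_< 2 ^ suc h) (sym (length-map (a ∷_) vs))
          (path-length h (Linked-map-∷⁻ l) (Unique.map⁻ u) (Depth≤-map-∷⁻ d))

  path-length zero    _ u d = s≤s (Unique-Depth≤0⇒length≤1 u d)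
  path-length (suc h) {xs} l u d with any? []≟ xs
  ... | no root∉ = <-≤-trans (rootless-path-length h l u d (All.¬Any⇒All¬ xs root∉))
                             (^-monoʳ-≤ 2 (n≤1+n (suc h)))
  ... | yes root∈ with as , bs , refl ← ∈-∃++ root∈
    with nonroots ∷ u′ ← Unique-resp-↭ (root-shift as) u
    with l-as , l-root∷bs ← Linked-++⁻ as l | d-as , _ ∷ d-bs ← All.++⁻ as d
    with r-as , r-bs ← All.++⁻ as nonroots | u-as , u-bs ← AllPairs-++⁻ as u′
    = subst (_< 2 ^ suc (suc h)) (sym (length-++ as))
        (+-suc-<-2^suc (suc h) (rootless-path-length h l-as u-as d-as r-as)
                        (rootless-path-length h (Linked.tail l-root∷bs) u-bs d-bs r-bs))

  cycle-length : ∀ h {xs} → Cyclic Comparable xs → Unique xs → All (Depth≤ h) xs →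
                 length xs ≤ 2 ^ h
  cycle-length zero         _ u d = Unique-Depth≤0⇒length≤1 u d
  cycle-length (suc h) {xs} c u d with any? []≟ xs
  ... | no root∉ = <⇒≤ (rootless-path-length h (proj₁ c) u d (All.¬Any⇒All¬ xs root∉))
  ... | yes root∈ with as , bs , refl ← ∈-∃++ root∈
    with nonroots ∷ u′ ← Unique-resp-↭ (root-rotate as) u
    with _ ∷ d′ ← All-resp-↭ (root-rotate as) d
    = subst (_≤ 2 ^ suc h) (sym (↭-length (root-rotate as)))
        (rootless-path-length h (Cyclic-delete as c) u′ d′ nonroots)

module TreeClosure (d : ℕ) where

  open Words {Fin d}

  size : ℕ → ℕ
  size zero    = 1
  size (suc h) = suc (d * size h)

  -- Vertex 0 is the root; vertex 1 + combine a x is vertex x of the a-th subtree.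
  address : ∀ h → Fin (size h) → List (Fin d)
  address zero    _       = []
  address (suc h) zero    = []
  address (suc h) (suc i) =
    proj₁ (remQuot {d} (size h) i) ∷ address h (proj₂ (remQuot {d} (size h) i))

  child : ∀ {h} → Fin d → Fin (size h) → Fin (size (suc h))
  child a x = suc (combine a x)

  address-child : ∀ h a x → address (suc h) (child a x) ≡ a ∷ address h x
  address-child h a x = cong (λ (b , y) → b ∷ address h y) (remQuot-combine a x)

  child-injective : ∀ {h a b} {x y : Fin (size h)} → child a x ≡ child b y → a ≡ b × x ≡ y
  child-injective = combine-injective _ _ _ _ ∘ suc-injective

  address-injective : ∀ h {u v} → address h u ≡ address h v → u ≡ v
  address-injective zero    {zero}  {zero}  _  = refl
  address-injective (suc h) {zero}  {zero}  _  = refl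
  address-injective (suc h) {suc i} {suc j} eq =
    cong suc (remQuot-injective {d} (size h)
               (×-≡,≡→≡ (Product.map₂ (address-injective h) (∷-injective eq))))

  address-depth : ∀ h u → Depth≤ h (address h u)
  address-depth zero    _       = z≤n
  address-depth (suc h) zero    = z≤n
  address-depth (suc h) (suc i) = s≤s (address-depth h _)

  graph : ℕ → Graph
  graph h = record
    { n      = size h
    ; Adj    = λ u v → Comparable (address h u) (address h v)
    ; sym    = Comparable-sym
    ; irrefl = Comparable-irrefl
    }

  circumference : ∀ h L → Cycle (graph h) L → L ≤ 2 ^ h
  circumference h L C =
    subst (_≤ 2 ^ h) (length-tabulate (address h ∘ vertex))
      (cycle-length h (tabulate-Cyclic (address h ∘ vertex) adj)
                      (Unique.tabulate⁺ (inj ∘ address-injective h))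
                      (All.tabulate⁺ (address-depth h ∘ vertex)))
    where open Cycle C

  child-Adj : ∀ {h} a {u v} → Adj (graph h) u v → Adj (graph (suc h)) (child a u) (child a v)
  child-Adj {h} a {u} {v} u~v =
    subst₂ Comparable (sym (address-child h a u)) (sym (address-child h a v)) (Comparable-∷⁺ u~v)

  child-MonoDegAtLeast : ∀ {h k m} (c : Colouring (graph (suc h)) k) a {v} →
                         MonoDegAtLeast (graph h) (c ∘ child a) v m →
                         MonoDegAtLeast (graph (suc h)) c (child a v) m
  child-MonoDegAtLeast c a (w , w-injective , w-mono) =
    child a ∘ w , w-injective ∘ proj₂ ∘ child-injective ,
    λ j → child-Adj a (proj₁ (w-mono j)) , proj₂ (w-mono j)

  root-MonoDegAtLeast : ∀ {h k} (c : Colouring (graph (suc h)) k) →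
                        (∀ a → ∃ λ x → c (child a x) ≡ c zero) →
                        MonoDegAtLeast (graph (suc h)) c zero d
  root-MonoDegAtLeast c hits =
    (λ a → child a (proj₁ (hits a))) , proj₁ ∘ child-injective ,
    λ a → inj₁ []⊏∷ , proj₂ (hits a)

  root-colour-in? : ∀ {h k m} (c : Colouring (graph (suc h)) k) a (f : Fin m → Fin (size h)) →
                    Dec (∃ λ j → c (child a (f j)) ≡ c zero)
  root-colour-in? c a f = Fin.any? λ j → c (child a (f j)) ≟ c zero

  MonoDeg-or-Rainbow : ∀ h {k} (c : Colouring (graph h) k) →
                       (∃ λ v → MonoDegAtLeast (graph h) c v d) ⊎ Rainbow (graph h) c (suc h)
  MonoDeg-or-Rainbow zero    c = inj₂ ((λ _ → zero) , λ { {zero} {zero} _ → refl })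
  MonoDeg-or-Rainbow (suc h) c with ∃⊎∀ (λ a → MonoDeg-or-Rainbow h (c ∘ child a))
  ... | inj₁ (a , v , mono) = inj₁ (child a v , child-MonoDegAtLeast c a mono)
  ... | inj₂ rainbow with Fin.all? (λ a → root-colour-in? c a (proj₁ (rainbow a)))
  ...   | yes hits =
    inj₁ (zero , root-MonoDegAtLeast c (λ a → proj₁ (rainbow a) (proj₁ (hits a)) , proj₂ (hits a)))
  ...   | no ¬hits
    with a , missed ← ¬∀⟶∃¬ _ _ (λ a → root-colour-in? c a (proj₁ (rainbow a))) ¬hits =
    inj₂ (Rainbow-∷ (graph (suc h)) c zero (child a ∘ proj₁ (rainbow a) , proj₂ (rainbow a)) missed)

proposition3 : (k d : ℕ) → k ≥ 1 → d ≥ 1 →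
    Σ Graph λ G → CircumferenceAtMost G (2 ^ k) ×
      ((c : Colouring G k) → Σ (Fin (n G)) λ v → MonoDegAtLeast G c v d)
proposition3 k d k≥1 _ = graph k , (^-monoʳ-≤ 2 k≥1 , circumference k) , monochromatic
  where
    open TreeClosure d
    monochromatic : (c : Colouring (graph k) k) → ∃ λ v → MonoDegAtLeast (graph k) c v d
    monochromatic c with MonoDeg-or-Rainbow k c
    ... | inj₁ mono    = mono
    ... | inj₂ rainbow = ⊥-elim (no-Rainbow (graph k) c rainbow)
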